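{- Let $p$ be a prime and let $k, s, c$ be nonnegative integers with $0 \le c \le p-2$. Then $$\sum_{\substack{r_1+\dots+r_{p-1}=(p-1)s+c\\ r_i \ge 0}} \binom{k}{r_1}\cdots\binom{k}{r_{p-1}}\, 1^{r_1}2^{r_2}\cdots(p-1)^{r_{p-1}} \equiv \begin{cases} (-1)^s\binom{k}{s} \pmod p & \text{if } c=0,\\ 0 \pmod p & \text{otherwise.}\end{cases}$$ -}

module Defs where

open import Data.Nat using (ℕ; zero; suc; _+_; _*_; _∸_; _^_)
open import Data.Nat.Combinatorics using (_C_)
open import Data.List using (List; []; _∷_; map; concatMap; upTo; zipWith; length)
open import Data.Nat.ListAction using (sum; product)
open import Data.Integer using (ℤ; +_; -_; _-_)
open import Data.Integer.Divisibility using () renaming (_∣_ to _∣ℤ_)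

compositions : ℕ → ℕ → List (List ℕ)
compositions zero zero = [] ∷ []
compositions zero (suc N) = []
compositions (suc m) N =
  concatMap (λ r → map (r ∷_) (compositions m (N ∸ r))) (upTo (suc N))

term : ℕ → List ℕ → ℕ
term k rs = product (zipWith (λ i r → (k C r) * (i ^ r)) (map suc (upTo (length rs))) rs)

compSum : (k m N : ℕ) → ℕ
compSum k m N = sum (map (term k) (compositions m N))

_≡_[modℤ_] : ℤ → ℤ → ℕ → Set
a ≡ b [modℤ p ] = (+ p) ∣ℤ (a - b)

sign : ℕ → ℤ
sign zero = + 1
sign (suc s) = - sign s

rhs : (k s c : ℕ) → ℤ
rhs k s zero = sign s Data.Integer.* (+ (k C s))
rhs k s (suc c) = + 0

module Submission where

-- Lemma 2.1.  Write m = p - 1.  Expanding the product, compSum k m N is the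
-- coefficient of x^N in  ∏_{i=1}^{m} (1 + i x)^k = (∏_{i=1}^{m} (1 + i x))^k.
-- Modulo the prime p we have, coefficientwise,
--     ∏_{i=1}^{m} (1 + i x)  ≡  1 - x^m :
-- read backwards (x^m f(1/x)) the two sides are ∏_{i=1}^{m} (x + i) and x^m - 1,
-- both monic of degree m and both vanishing at x = 1, …, m (the first because
-- a + (p - a) = p, the second by Fermat's little theorem); their difference has
-- degree < m and m roots that are distinct modulo p, hence is ≡ 0.  So compSum is
-- congruent to the coefficient of x^N in (1 - x^m)^k = Σ_s (-1)^s C(k,s) x^{sm}.

open import Defs

module Proof where

  open import Data.Nat as ℕ using (ℕ; zero; suc; z≤n; s≤s)
  import Data.Nat.Properties as ℕP
  open import Data.Nat.Primality using (Prime)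
  open import Data.Integer as ℤ using (ℤ; +_; -_; _+_; _-_; _*_; 0ℤ; 1ℤ)
  open import Data.Integer.Properties
    using (+-identityˡ; +-identityʳ; +-inverseʳ; +-assoc; +-comm; *-comm; *-assoc; *-identityˡ;
           *-zeroˡ; *-zeroʳ; *-distribʳ-+; *-distribˡ-+)
  open import Data.Integer.Divisibility.Signed as Signed
    using (divides; ∣m∣n⇒∣m+n; ∣m⇒∣-m; ∣n⇒∣m*n; ∣⇒∣ᵤ; ∣ᵤ⇒∣)
  open import Data.Integer.Tactic.RingSolver using (solve-∀)
  open import Data.Empty using (⊥-elim)
  open import Function using (_∘_)
  open import Level using (0ℓ)
  open import Relation.Binary.Bundles using (Setoid)
  import Relation.Binary.Reasoning.Setoid as SetoidReasoning
  open import Relation.Binary.PropositionalEquality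
    using (_≡_; _≢_; _≗_; refl; sym; trans; cong; cong₂; subst; module ≡-Reasoning)

  module Congruence (p : ℕ) where

    -- a ≈ b means p ∣ a - b; a record, so that a and b can be read off a proof.
    infix 4 _≈_
    record _≈_ (a b : ℤ) : Set where
      constructor mod
      field divides-difference : + p Signed.∣ a - b

    private
      respect : ∀ {x y} → x ≡ y → + p Signed.∣ x → + p Signed.∣ y
      respect = subst (+ p Signed.∣_)

    ≈⇒[modℤ] : ∀ {a b} → a ≈ b → a ≡ b [modℤ p ]
    ≈⇒[modℤ] (mod d) = ∣⇒∣ᵤ d

    ≈-refl : ∀ {a} → a ≈ a
    ≈-refl {a} = mod (respect (sym (+-inverseʳ a)) (divides 0ℤ refl))

    ≈-sym : ∀ {a b} → a ≈ b → b ≈ a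
    ≈-sym {a} {b} (mod d) = mod (respect (negate a b) (∣m⇒∣-m d))
      where
      negate : ∀ a b → - (a - b) ≡ b - a
      negate = solve-∀

    ≈-trans : ∀ {a b c} → a ≈ b → b ≈ c → a ≈ c
    ≈-trans {a} {b} {c} (mod d) (mod e) = mod (respect (telescope a b c) (∣m∣n⇒∣m+n d e))
      where
      telescope : ∀ a b c → (a - b) + (b - c) ≡ a - c
      telescope = solve-∀

    ≈-setoid : Setoid 0ℓ 0ℓ
    ≈-setoid = record
      { Carrier = ℤ ; _≈_ = _≈_
      ; isEquivalence = record { refl = ≈-refl ; sym = ≈-sym ; trans = ≈-trans } }

    module ≈-Reasoning = SetoidReasoning ≈-setoid

    ≡⇒≈ : ∀ {a b} → a ≡ b → a ≈ b
    ≡⇒≈ refl = ≈-refl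

    +-cong : ∀ {a b c d} → a ≈ b → c ≈ d → a + c ≈ b + d
    +-cong {a} {b} {c} {d} (mod d₁) (mod d₂) = mod (respect (regroup a b c d) (∣m∣n⇒∣m+n d₁ d₂))
      where
      regroup : ∀ a b c d → (a - b) + (c - d) ≡ (a + c) - (b + d)
      regroup = solve-∀

    -‿cong : ∀ {a b} → a ≈ b → - a ≈ - b
    -‿cong {a} {b} (mod d) = mod (respect (negate a b) (∣m⇒∣-m d))
      where
      negate : ∀ a b → - (a - b) ≡ - a - - b
      negate = solve-∀

    *-cong : ∀ {a b c d} → a ≈ b → c ≈ d → a * c ≈ b * d
    *-cong {a} {b} {c} {d} (mod d₁) (mod d₂) =
      mod (respect (regroup a b c d) (∣m∣n⇒∣m+n (∣n⇒∣m*n a d₂) (∣n⇒∣m*n d d₁)))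
      where
      regroup : ∀ a b c d → a * (c - d) + d * (a - b) ≡ a * c - b * d
      regroup = solve-∀

    multiple⇒≈0 : ∀ {a} → + p Signed.∣ a → a ≈ 0ℤ
    multiple⇒≈0 {a} d = mod (respect (sym (+-identityʳ a)) d)

    ≈0⇒multiple : ∀ {a} → a ≈ 0ℤ → + p Signed.∣ a
    ≈0⇒multiple {a} (mod d) = respect (+-identityʳ a) d

  module PowerSeries where

    Series : Set
    Series = ℕ → ℤ

    infixl 7 _⊛_
    infixl 6 _⊕_ _⊖_
    infixr 8 _·_

    _⊕_ _⊖_ : Series → Series → Series
    (F ⊕ G) j = F j + G j
    (F ⊖ G) j = F j - G j

    _·_ : ℤ → Series → Series
    (a · F) j = a * F j

    -- Cauchy product: (F ⊛ G) n = Σ_{i ≤ n} F i * G (n - i), peeling off i = 0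
    _⊛_ : Series → Series → Series
    (F ⊛ G) zero = F 0 * G 0
    (F ⊛ G) (suc n) = F 0 * G (suc n) + (F ∘ suc ⊛ G) n

    mono : ℕ → Series
    mono zero zero = 1ℤ
    mono zero (suc j) = 0ℤ
    mono (suc a) zero = 0ℤ
    mono (suc a) (suc j) = mono a j

    mono-diag : ∀ a → mono a a ≡ 1ℤ
    mono-diag zero = refl
    mono-diag (suc a) = mono-diag a

    mono-off : ∀ a j → j ≢ a → mono a j ≡ 0ℤ
    mono-off zero zero j≢a = ⊥-elim (j≢a refl)
    mono-off zero (suc j) _ = refl
    mono-off (suc a) zero _ = refl
    mono-off (suc a) (suc j) j≢a = mono-off a j (j≢a ∘ cong suc)

    lin : ℕ → Series
    lin c zero = 1ℤ
    lin c (suc zero) = + c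
    lin c (suc (suc j)) = 0ℤ

    ∏ : (ℕ → Series) → ℕ → Series
    ∏ Fs zero = mono 0
    ∏ Fs (suc m) = Fs 0 ⊛ ∏ (Fs ∘ suc) m

    power : Series → ℕ → Series
    power F k = ∏ (λ _ → F) k

    ⊛-cong : ∀ {F F′ G G′} → F ≗ F′ → G ≗ G′ → F ⊛ G ≗ F′ ⊛ G′
    ⊛-cong eF eG zero = cong₂ _*_ (eF 0) (eG 0)
    ⊛-cong eF eG (suc n) = cong₂ _+_ (cong₂ _*_ (eF 0) (eG (suc n))) (⊛-cong (eF ∘ suc) eG n)

    ⊛-last : ∀ F G n → (F ⊛ G) (suc n) ≡ (F ⊛ G ∘ suc) n + F (suc n) * G 0
    ⊛-last F G zero = refl
    ⊛-last F G (suc n) = begin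
        F 0 * G (suc (suc n)) + (F ∘ suc ⊛ G) (suc n)
      ≡⟨ cong (_+_ (F 0 * G (suc (suc n)))) (⊛-last (F ∘ suc) G n) ⟩
        F 0 * G (suc (suc n)) + ((F ∘ suc ⊛ G ∘ suc) n + F (suc (suc n)) * G 0)
      ≡⟨ +-assoc (F 0 * G (suc (suc n))) _ _ ⟨
        (F ⊛ G ∘ suc) (suc n) + F (suc (suc n)) * G 0
      ∎
      where open ≡-Reasoning

    ⊛-comm : ∀ F G → F ⊛ G ≗ G ⊛ F
    ⊛-comm F G zero = *-comm (F 0) (G 0)
    ⊛-comm F G (suc n) = begin
        (F ⊛ G) (suc n)
      ≡⟨ ⊛-last F G n ⟩
        (F ⊛ G ∘ suc) n + F (suc n) * G 0
      ≡⟨ cong₂ _+_ (⊛-comm F (G ∘ suc) n) (*-comm (F (suc n)) (G 0)) ⟩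
        (G ∘ suc ⊛ F) n + G 0 * F (suc n)
      ≡⟨ +-comm _ (G 0 * F (suc n)) ⟩
        (G ⊛ F) (suc n)
      ∎
      where open ≡-Reasoning

    ⊛-zeroˡ : ∀ G → (λ _ → 0ℤ) ⊛ G ≗ (λ _ → 0ℤ)
    ⊛-zeroˡ G zero = refl
    ⊛-zeroˡ G (suc n) = trans (+-identityˡ _) (⊛-zeroˡ G n)

    ⊛-identityˡ : ∀ G → mono 0 ⊛ G ≗ G
    ⊛-identityˡ G zero = *-identityˡ (G 0)
    ⊛-identityˡ G (suc n) =
      trans (cong₂ _+_ (*-identityˡ (G (suc n))) (⊛-zeroˡ G n)) (+-identityʳ (G (suc n)))

    ⊛-distribʳ-⊕ : ∀ F G H → (F ⊕ G) ⊛ H ≗ F ⊛ H ⊕ G ⊛ H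
    ⊛-distribʳ-⊕ F G H zero = *-distribʳ-+ (H 0) (F 0) (G 0)
    ⊛-distribʳ-⊕ F G H (suc n) = begin
        (F 0 + G 0) * H (suc n) + ((F ∘ suc ⊕ G ∘ suc) ⊛ H) n
      ≡⟨ cong₂ _+_ (*-distribʳ-+ (H (suc n)) (F 0) (G 0)) (⊛-distribʳ-⊕ (F ∘ suc) (G ∘ suc) H n) ⟩
        (F 0 * H (suc n) + G 0 * H (suc n)) + ((F ∘ suc ⊛ H) n + (G ∘ suc ⊛ H) n)
      ≡⟨ interchange (F 0 * H (suc n)) (G 0 * H (suc n)) _ _ ⟩
        (F ⊛ H ⊕ G ⊛ H) (suc n)
      ∎
      where
      open ≡-Reasoning
      interchange : ∀ a b c d → (a + b) + (c + d) ≡ (a + c) + (b + d)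
      interchange = solve-∀

    ⊛-distribʳ-⊖ : ∀ F G H → (F ⊖ G) ⊛ H ≗ F ⊛ H ⊖ G ⊛ H
    ⊛-distribʳ-⊖ F G H zero = distrib (F 0) (G 0) (H 0)
      where
      distrib : ∀ a b h → (a - b) * h ≡ a * h - b * h
      distrib = solve-∀
    ⊛-distribʳ-⊖ F G H (suc n) = begin
        (F 0 - G 0) * H (suc n) + ((F ∘ suc ⊖ G ∘ suc) ⊛ H) n
      ≡⟨ cong (_+_ ((F 0 - G 0) * H (suc n))) (⊛-distribʳ-⊖ (F ∘ suc) (G ∘ suc) H n) ⟩
        (F 0 - G 0) * H (suc n) + ((F ∘ suc ⊛ H) n - (G ∘ suc ⊛ H) n)
      ≡⟨ regroup (F 0) (G 0) (H (suc n)) _ _ ⟩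
        (F ⊛ H ⊖ G ⊛ H) (suc n)
      ∎
      where
      open ≡-Reasoning
      regroup : ∀ a b h u v → (a - b) * h + (u - v) ≡ (a * h + u) - (b * h + v)
      regroup = solve-∀

    ⊛-scalarˡ : ∀ a F H → (a · F) ⊛ H ≗ a · (F ⊛ H)
    ⊛-scalarˡ a F H zero = *-assoc a (F 0) (H 0)
    ⊛-scalarˡ a F H (suc n) = begin
        a * F 0 * H (suc n) + ((a · F ∘ suc) ⊛ H) n
      ≡⟨ cong₂ _+_ (*-assoc a (F 0) (H (suc n))) (⊛-scalarˡ a (F ∘ suc) H n) ⟩
        a * (F 0 * H (suc n)) + a * (F ∘ suc ⊛ H) n
      ≡⟨ *-distribˡ-+ a _ _ ⟨
        (a · (F ⊛ H)) (suc n)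
      ∎
      where open ≡-Reasoning

    ⊛-assoc : ∀ F G H → (F ⊛ G) ⊛ H ≗ F ⊛ (G ⊛ H)
    ⊛-assoc F G H zero = *-assoc (F 0) (G 0) (H 0)
    ⊛-assoc F G H (suc n) = begin
        (F 0 * G 0) * H (suc n) + ((F ⊛ G) ∘ suc ⊛ H) n
      ≡⟨ cong (_+_ ((F 0 * G 0) * H (suc n))) tail ⟩
        (F 0 * G 0) * H (suc n) + (F 0 * (G ∘ suc ⊛ H) n + (F ∘ suc ⊛ (G ⊛ H)) n)
      ≡⟨ regroup (F 0) (G 0) (H (suc n)) _ _ ⟩
        (F ⊛ (G ⊛ H)) (suc n)
      ∎
      where
      open ≡-Reasoning
      regroup : ∀ a b c d e → (a * b) * c + (a * d + e) ≡ a * (b * c + d) + e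
      regroup = solve-∀
      -- (F ⊛ G) ∘ suc is, by definition, F 0 · (G ∘ suc) ⊕ (F ∘ suc ⊛ G)
      tail : ((F ⊛ G) ∘ suc ⊛ H) n ≡ F 0 * (G ∘ suc ⊛ H) n + (F ∘ suc ⊛ (G ⊛ H)) n
      tail = trans (⊛-distribʳ-⊕ (F 0 · G ∘ suc) (F ∘ suc ⊛ G) H n)
                   (cong₂ _+_ (⊛-scalarˡ (F 0) (G ∘ suc) H n) (⊛-assoc (F ∘ suc) G H n))

    ⊛-interchange : ∀ F G P Q → (F ⊛ G) ⊛ (P ⊛ Q) ≗ (F ⊛ P) ⊛ (G ⊛ Q)
    ⊛-interchange F G P Q n = begin
        ((F ⊛ G) ⊛ (P ⊛ Q)) n
      ≡⟨ ⊛-assoc F G (P ⊛ Q) n ⟩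
        (F ⊛ (G ⊛ (P ⊛ Q))) n
      ≡⟨ ⊛-cong (λ _ → refl) middle n ⟩
        (F ⊛ (P ⊛ (G ⊛ Q))) n
      ≡⟨ ⊛-assoc F P (G ⊛ Q) n ⟨
        ((F ⊛ P) ⊛ (G ⊛ Q)) n
      ∎
      where
      open ≡-Reasoning
      middle : G ⊛ (P ⊛ Q) ≗ P ⊛ (G ⊛ Q)
      middle i = begin
          (G ⊛ (P ⊛ Q)) i           ≡⟨ ⊛-assoc G P Q i ⟨
          ((G ⊛ P) ⊛ Q) i           ≡⟨ ⊛-cong (⊛-comm G P) (λ _ → refl) i ⟩
          ((P ⊛ G) ⊛ Q) i           ≡⟨ ⊛-assoc P G Q i ⟩
          (P ⊛ (G ⊛ Q)) i           ∎

    ∏-cong : ∀ {Fs Gs} → (∀ j → Fs j ≗ Gs j) → ∀ m → ∏ Fs m ≗ ∏ Gs m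
    ∏-cong e zero n = refl
    ∏-cong e (suc m) = ⊛-cong (e 0) (∏-cong (e ∘ suc) m)

    ∏-⊛ : ∀ Fs Gs m → ∏ (λ j → Fs j ⊛ Gs j) m ≗ ∏ Fs m ⊛ ∏ Gs m
    ∏-⊛ Fs Gs zero n = sym (⊛-identityˡ (mono 0) n)
    ∏-⊛ Fs Gs (suc m) n =
      trans (⊛-cong (λ _ → refl) (∏-⊛ (Fs ∘ suc) (Gs ∘ suc) m) n)
            (⊛-interchange (Fs 0) (Gs 0) (∏ (Fs ∘ suc) m) (∏ (Gs ∘ suc) m) n)

    ∏-power : ∀ Fs k m → ∏ (λ j → power (Fs j) k) m ≗ power (∏ Fs m) k
    ∏-power Fs zero m = ∏-one m
      where
      ∏-one : ∀ m → ∏ (λ _ → mono 0) m ≗ mono 0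
      ∏-one zero n = refl
      ∏-one (suc m) n = trans (⊛-identityˡ _ n) (∏-one m n)
    ∏-power Fs (suc k) m n =
      trans (∏-⊛ Fs (λ j → power (Fs j) k) m n)
            (⊛-cong (λ _ → refl) (∏-power Fs k m) n)

    mono⊛-≤ : ∀ a H N → a ℕ.≤ N → (mono a ⊛ H) N ≡ H (N ℕ.∸ a)
    mono⊛-≤ zero H N _ = ⊛-identityˡ H N
    mono⊛-≤ (suc a) H (suc N) (s≤s a≤N) =
      trans (cong (_+ (mono a ⊛ H) N) (*-zeroˡ (H (suc N))))
            (trans (+-identityˡ _) (mono⊛-≤ a H N a≤N))

    mono⊛-> : ∀ a H N → N ℕ.< a → (mono a ⊛ H) N ≡ 0ℤ
    mono⊛-> (suc a) H zero _ = *-zeroˡ (H 0)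
    mono⊛-> (suc a) H (suc N) (s≤s N<a) =
      trans (cong (_+ (mono a ⊛ H) N) (*-zeroˡ (H (suc N))))
            (trans (+-identityˡ _) (mono⊛-> a H N N<a))

    lin⊛-zero : ∀ c F → (lin c ⊛ F) 0 ≡ F 0
    lin⊛-zero c F = *-identityˡ (F 0)

    lin⊛-suc : ∀ c F j → (lin c ⊛ F) (suc j) ≡ F (suc j) + + c * F j
    lin⊛-suc c F j = cong₂ _+_ (*-identityˡ (F (suc j))) (tail j)
      where
      tail : ∀ j → (lin c ∘ suc ⊛ F) j ≡ + c * F j
      tail zero = refl
      tail (suc j) = trans (cong (_+_ (+ c * F (suc j))) (⊛-zeroˡ F j)) (+-identityʳ _)

  module Binomials where
    open PowerSeries
    open import Data.Nat.Combinatorics using (_C_; nCk+nC[k+1]≡[n+1]C[k+1]; nC1≡n)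
    open import Data.Nat.Tactic.RingSolver using () renaming (solve-∀ to solve-∀ℕ)
    open import Data.Integer.Properties using (pos-+; pos-*)

    binomialTerm : ℕ → ℕ → ℕ → ℕ
    binomialTerm k c r = (k C r) ℕ.* c ℕ.^ r

    binomialSeries : ℕ → ℕ → Series
    binomialSeries k c r = + binomialTerm k c r

    binomialTerm-pascal : ∀ k c r →
      binomialTerm k c (suc r) ℕ.+ c ℕ.* binomialTerm k c r ≡ binomialTerm (suc k) c (suc r)
    binomialTerm-pascal k c r = begin
        (k C suc r) ℕ.* (c ℕ.* c ℕ.^ r) ℕ.+ c ℕ.* ((k C r) ℕ.* c ℕ.^ r)
      ≡⟨ factor (k C suc r) (k C r) c (c ℕ.^ r) ⟩
        ((k C r) ℕ.+ (k C suc r)) ℕ.* (c ℕ.* c ℕ.^ r)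
      ≡⟨ cong (ℕ._* (c ℕ.* c ℕ.^ r)) (nCk+nC[k+1]≡[n+1]C[k+1] k r) ⟩
        (suc k C suc r) ℕ.* (c ℕ.* c ℕ.^ r)
      ∎
      where
      open ≡-Reasoning
      factor : ∀ a b c d → a ℕ.* (c ℕ.* d) ℕ.+ c ℕ.* (b ℕ.* d) ≡ (b ℕ.+ a) ℕ.* (c ℕ.* d)
      factor = solve-∀ℕ

    power-lin : ∀ c k → power (lin c) k ≗ binomialSeries k c
    power-lin c zero zero = refl
    power-lin c zero (suc r) = refl
    power-lin c (suc k) zero = trans (lin⊛-zero c (power (lin c) k)) (power-lin c k zero)
    power-lin c (suc k) (suc r) = begin
        (lin c ⊛ power (lin c) k) (suc r)
      ≡⟨ lin⊛-suc c (power (lin c) k) r ⟩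
        power (lin c) k (suc r) + + c * power (lin c) k r
      ≡⟨ cong₂ (λ u v → u + + c * v) (power-lin c k (suc r)) (power-lin c k r) ⟩
        + binomialTerm k c (suc r) + + c * + binomialTerm k c r
      ≡⟨ cong (_+_ (+ binomialTerm k c (suc r))) (pos-* c (binomialTerm k c r)) ⟨
        + binomialTerm k c (suc r) + + (c ℕ.* binomialTerm k c r)
      ≡⟨ pos-+ (binomialTerm k c (suc r)) (c ℕ.* binomialTerm k c r) ⟨
        + (binomialTerm k c (suc r) ℕ.+ c ℕ.* binomialTerm k c r)
      ≡⟨ cong +_ (binomialTerm-pascal k c r) ⟩
        binomialSeries (suc k) c (suc r)
      ∎
      where open ≡-Reasoning

    absorption : ∀ n k → suc k ℕ.* (suc n C suc k) ≡ suc n ℕ.* (n C k)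
    absorption zero zero = refl
    absorption zero (suc k) = ℕP.*-zeroʳ (suc (suc k))
    absorption (suc n) zero = trans (ℕP.+-identityʳ _) (trans (nC1≡n (suc (suc n))) (sym (ℕP.*-identityʳ _)))
    absorption (suc n) (suc k) = begin
        suc (suc k) ℕ.* (suc (suc n) C suc (suc k))
      ≡⟨ cong (suc (suc k) ℕ.*_) (nCk+nC[k+1]≡[n+1]C[k+1] (suc n) (suc k)) ⟨
        suc (suc k) ℕ.* ((suc n C suc k) ℕ.+ (suc n C suc (suc k)))
      ≡⟨ expand (suc n C suc k) (suc n C suc (suc k)) (suc k) ⟩
        suc k ℕ.* (suc n C suc k) ℕ.+ (suc n C suc k) ℕ.+ suc (suc k) ℕ.* (suc n C suc (suc k))
      ≡⟨ cong₂ (λ u v → u ℕ.+ (suc n C suc k) ℕ.+ v) (absorption n k) (absorption n (suc k)) ⟩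
        suc n ℕ.* (n C k) ℕ.+ (suc n C suc k) ℕ.+ suc n ℕ.* (n C suc k)
      ≡⟨ collect (suc n) (n C k) (n C suc k) (suc n C suc k) ⟩
        suc n ℕ.* ((n C k) ℕ.+ (n C suc k)) ℕ.+ (suc n C suc k)
      ≡⟨ cong (λ u → suc n ℕ.* u ℕ.+ (suc n C suc k)) (nCk+nC[k+1]≡[n+1]C[k+1] n k) ⟩
        suc n ℕ.* (suc n C suc k) ℕ.+ (suc n C suc k)
      ≡⟨ ℕP.+-comm (suc n ℕ.* (suc n C suc k)) _ ⟩
        suc (suc n) ℕ.* (suc n C suc k)
      ∎
      where
      open ≡-Reasoning
      expand : ∀ a b k → suc k ℕ.* (a ℕ.+ b) ≡ k ℕ.* a ℕ.+ a ℕ.+ suc k ℕ.* b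
      expand = solve-∀ℕ
      collect : ∀ n a b c → n ℕ.* a ℕ.+ c ℕ.+ n ℕ.* b ≡ n ℕ.* (a ℕ.+ b) ℕ.+ c
      collect = solve-∀ℕ

  -- compSum k m N is the coefficient of x^N in ∏_{i=1}^{m} (1 + i x)^k: expanding
  -- the product, the tuples (r₁,…,r_m) with Σ rᵢ = N index exactly the summands.
  module CompositionSums where
    open PowerSeries
    open Binomials
    open import Data.List using (List; []; _∷_; map; applyUpTo; upTo; zipWith; length; concatMap; _++_)
    open import Data.List.Properties using (map-++; map-cong; map-upTo)
    open import Data.Nat.ListAction using (sum; product)
    open import Data.Nat.ListAction.Properties using (sum-++)
    open import Data.Nat.Combinatorics using (_C_)
    open import Data.Integer.Properties using (pos-+; pos-*)

    weightedTerm : ℕ → (ℕ → ℕ) → List ℕ → ℕ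
    weightedTerm k w [] = 1
    weightedTerm k w (r ∷ rs) = binomialTerm k (w 0) r ℕ.* weightedTerm k (w ∘ suc) rs

    weightedSum : ℕ → (ℕ → ℕ) → ℕ → ℕ → ℕ
    weightedSum k w m N = sum (map (weightedTerm k w) (compositions m N))

    compSum≡weightedSum : ∀ k m N → compSum k m N ≡ weightedSum k suc m N
    compSum≡weightedSum k m N = cong sum (map-cong termForm (compositions m N))
      where
      zipped : ∀ w rs →
        product (zipWith (λ i r → (k C r) ℕ.* i ℕ.^ r) (applyUpTo w (length rs)) rs) ≡ weightedTerm k w rs
      zipped w [] = refl
      zipped w (r ∷ rs) = cong (binomialTerm k (w 0) r ℕ.*_) (zipped (w ∘ suc) rs)
      termForm : ∀ rs → term k rs ≡ weightedTerm k suc rs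
      termForm rs = trans (cong (λ ws → product (zipWith (λ i r → (k C r) ℕ.* i ℕ.^ r) ws rs))
                                (map-upTo suc (length rs)))
                          (zipped suc rs)

    sum-concatMap : ∀ {A B : Set} (f : B → ℕ) (g : A → List B) xs →
      sum (map f (concatMap g xs)) ≡ sum (map (λ x → sum (map f (g x))) xs)
    sum-concatMap f g [] = refl
    sum-concatMap f g (x ∷ xs) = begin
        sum (map f (g x ++ concatMap g xs))
      ≡⟨ cong sum (map-++ f (g x) (concatMap g xs)) ⟩
        sum (map f (g x) ++ map f (concatMap g xs))
      ≡⟨ sum-++ (map f (g x)) (map f (concatMap g xs)) ⟩
        sum (map f (g x)) ℕ.+ sum (map f (concatMap g xs))
      ≡⟨ cong (sum (map f (g x)) ℕ.+_) (sum-concatMap f g xs) ⟩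
        sum (map (λ x → sum (map f (g x))) (x ∷ xs))
      ∎
      where open ≡-Reasoning

    sum-prefixed : ∀ k w r L →
      sum (map (weightedTerm k w) (map (r ∷_) L)) ≡ binomialTerm k (w 0) r ℕ.* sum (map (weightedTerm k (w ∘ suc)) L)
    sum-prefixed k w r [] = sym (ℕP.*-zeroʳ (binomialTerm k (w 0) r))
    sum-prefixed k w r (rs ∷ L) =
      trans (cong (binomialTerm k (w 0) r ℕ.* weightedTerm k (w ∘ suc) rs ℕ.+_) (sum-prefixed k w r L))
            (sym (ℕP.*-distribˡ-+ (binomialTerm k (w 0) r) _ _))

    weightedSum-suc : ∀ k w m N → weightedSum k w (suc m) N ≡
      sum (map (λ r → binomialTerm k (w 0) r ℕ.* weightedSum k (w ∘ suc) m (N ℕ.∸ r)) (upTo (suc N)))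
    weightedSum-suc k w m N =
      trans (sum-concatMap (weightedTerm k w) (λ r → map (r ∷_) (compositions m (N ℕ.∸ r))) (upTo (suc N)))
            (cong sum (map-cong (λ r → sum-prefixed k w r (compositions m (N ℕ.∸ r))) (upTo (suc N))))

    ⊛-as-sum : ∀ F G N (φ : ℕ → ℕ) → (∀ r → + φ r ≡ F r * G (N ℕ.∸ r)) →
      + sum (applyUpTo φ (suc N)) ≡ (F ⊛ G) N
    ⊛-as-sum F G zero φ eq = trans (cong +_ (ℕP.+-identityʳ (φ 0))) (eq 0)
    ⊛-as-sum F G (suc N) φ eq =
      trans (pos-+ (φ 0) _) (cong₂ _+_ (eq 0) (⊛-as-sum (F ∘ suc) G N (φ ∘ suc) (eq ∘ suc)))

    weightedSum-as-coefficient : ∀ k w m N →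
      + weightedSum k w m N ≡ ∏ (λ j → binomialSeries k (w j)) m N
    weightedSum-as-coefficient k w zero zero = refl
    weightedSum-as-coefficient k w zero (suc N) = refl
    weightedSum-as-coefficient k w (suc m) N = begin
        + weightedSum k w (suc m) N
      ≡⟨ cong +_ (trans (weightedSum-suc k w m N) (cong sum (map-upTo φ (suc N)))) ⟩
        + sum (applyUpTo φ (suc N))
      ≡⟨ ⊛-as-sum (binomialSeries k (w 0)) (∏ (λ j → binomialSeries k (w (suc j))) m) N φ summand ⟩
        ∏ (λ j → binomialSeries k (w j)) (suc m) N
      ∎
      where
      open ≡-Reasoning
      φ : ℕ → ℕ
      φ r = binomialTerm k (w 0) r ℕ.* weightedSum k (w ∘ suc) m (N ℕ.∸ r)
      summand : ∀ r → + φ r ≡ binomialSeries k (w 0) r * ∏ (λ j → binomialSeries k (w (suc j))) m (N ℕ.∸ r)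
      summand r = trans (pos-* (binomialTerm k (w 0) r) _)
                        (cong (binomialSeries k (w 0) r *_) (weightedSum-as-coefficient k (w ∘ suc) m (N ℕ.∸ r)))

    compSum-as-coefficient : ∀ k m N → + compSum k m N ≡ power (∏ (lin ∘ suc) m) k N
    compSum-as-coefficient k m N = begin
        + compSum k m N
      ≡⟨ cong +_ (compSum≡weightedSum k m N) ⟩
        + weightedSum k suc m N
      ≡⟨ weightedSum-as-coefficient k suc m N ⟩
        ∏ (λ j → binomialSeries k (suc j)) m N
      ≡⟨ ∏-cong (λ j r → sym (power-lin (suc j) k r)) m N ⟩
        ∏ (λ j → power (lin (suc j)) k) m N
      ≡⟨ ∏-power (lin ∘ suc) k m N ⟩
        power (∏ (lin ∘ suc) m) k N
      ∎
      where open ≡-Reasoning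

  -- Horner evaluation of the first n + 1 coefficients of a series, read with
  -- F 0 as the LEADING coefficient:  horner n F x = F 0 xⁿ + F 1 xⁿ⁻¹ + ⋯ + F n.
  -- For F = ∏_{j<n} (1 + c_j x) this is the "reversed" polynomial ∏_{j<n} (x + c_j),
  -- which lets us count roots of ∏ (x + i) while working with ∏ (1 + i x).
  module HornerEvaluation where
    open PowerSeries

    horner : ℕ → Series → ℤ → ℤ
    horner zero F x = F 0
    horner (suc n) F x = x * horner n F x + F (suc n)

    horner-⊕ : ∀ n F G x → horner n (F ⊕ G) x ≡ horner n F x + horner n G x
    horner-⊕ zero F G x = refl
    horner-⊕ (suc n) F G x =
      trans (cong (λ h → x * h + (F (suc n) + G (suc n))) (horner-⊕ n F G x)) (distrib x _ _ _ _)
      where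
      distrib : ∀ x a b c d → x * (a + b) + (c + d) ≡ (x * a + c) + (x * b + d)
      distrib = solve-∀

    horner-⊖ : ∀ n F G x → horner n (F ⊖ G) x ≡ horner n F x - horner n G x
    horner-⊖ zero F G x = refl
    horner-⊖ (suc n) F G x =
      trans (cong (λ h → x * h + (F (suc n) - G (suc n))) (horner-⊖ n F G x)) (distrib x _ _ _ _)
      where
      distrib : ∀ x a b c d → x * (a - b) + (c - d) ≡ (x * a + c) - (x * b + d)
      distrib = solve-∀

    horner-leading-zero : ∀ n F x → F 0 ≡ 0ℤ → horner (suc n) F x ≡ horner n (F ∘ suc) x
    horner-leading-zero zero F x F0≡0 =
      trans (cong (λ a → x * a + F 1) F0≡0) (trans (cong (_+ F 1) (*-zeroʳ x)) (+-identityˡ (F 1)))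
    horner-leading-zero (suc n) F x F0≡0 =
      cong (λ h → x * h + F (suc (suc n))) (horner-leading-zero n F x F0≡0)

    horner-mono-bottom : ∀ n x → horner n (mono 0) x ≡ x ℤ.^ n
    horner-mono-bottom zero x = refl
    horner-mono-bottom (suc n) x = trans (+-identityʳ _) (cong (x *_) (horner-mono-bottom n x))

    horner-mono-top : ∀ n x → horner n (mono n) x ≡ 1ℤ
    horner-mono-top zero x = refl
    horner-mono-top (suc n) x = trans (horner-leading-zero n (mono (suc n)) x refl) (horner-mono-top n x)

    -- synthetic division by x - a: the quotient has the partial Horner sums at a as coefficients
    partials : Series → ℤ → Series
    partials F a j = horner j F a

    horner-division : ∀ n F a x →
      horner (suc n) F x ≡ (x - a) * horner n (partials F a) x + horner (suc n) F a
    horner-division zero F a x = divide x a (F 0) (F 1)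
      where
      divide : ∀ x a b c → x * b + c ≡ (x - a) * b + (a * b + c)
      divide = solve-∀
    horner-division (suc n) F a x =
      trans (cong (λ h → x * h + F (suc (suc n))) (horner-division n F a x))
            (divide x a (horner n (partials F a) x) (horner (suc n) F a) (F (suc (suc n))))
      where
      divide : ∀ x a q r c → x * ((x - a) * q + r) + c ≡ (x - a) * (x * q + r) + (a * r + c)
      divide = solve-∀

    Degree≤ : ℕ → Series → Set
    Degree≤ n F = ∀ j → n ℕ.< j → F j ≡ 0ℤ

    lin⊛-degree : ∀ c n F → Degree≤ n F → Degree≤ (suc n) (lin c ⊛ F)
    lin⊛-degree c n F deg (suc j) (s≤s n<j) = begin
        (lin c ⊛ F) (suc j)
      ≡⟨ lin⊛-suc c F j ⟩
        F (suc j) + + c * F j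
      ≡⟨ cong₂ (λ u v → u + + c * v) (deg (suc j) (ℕP.m<n⇒m<1+n n<j)) (deg j n<j) ⟩
        0ℤ + + c * 0ℤ
      ≡⟨ cong (_+_ 0ℤ) (*-zeroʳ (+ c)) ⟩
        0ℤ
      ∎
      where open ≡-Reasoning

    horner-lin⊛ : ∀ c n F x → Degree≤ n F → horner (suc n) (lin c ⊛ F) x ≡ (x + + c) * horner n F x
    horner-lin⊛ c n F x deg = begin
        horner (suc n) (lin c ⊛ F) x
      ≡⟨ step n ⟩
        horner (suc n) F x + + c * horner n F x
      ≡⟨ cong (λ u → x * horner n F x + u + + c * horner n F x) (deg (suc n) ℕP.≤-refl) ⟩
        x * horner n F x + 0ℤ + + c * horner n F x
      ≡⟨ collect x (+ c) (horner n F x) ⟩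
        (x + + c) * horner n F x
      ∎
      where
      open ≡-Reasoning
      collect : ∀ x c h → x * h + 0ℤ + c * h ≡ (x + c) * h
      collect = solve-∀
      step : ∀ n → horner (suc n) (lin c ⊛ F) x ≡ horner (suc n) F x + + c * horner n F x
      step zero = trans (cong₂ (λ u v → x * u + v) (lin⊛-zero c F) (lin⊛-suc c F 0))
                        (regroup x (F 0) (F 1) (+ c))
        where
        regroup : ∀ x a b c → x * a + (b + c * a) ≡ x * a + b + c * a
        regroup = solve-∀
      step (suc n) = trans (cong₂ (λ u v → x * u + v) (step n) (lin⊛-suc c F (suc n)))
                           (regroup x (horner (suc n) F x) (horner n F x) (F (suc (suc n))) (F (suc n)) (+ c))
        where
        regroup : ∀ x h g a b c → x * (h + c * g) + (a + c * b) ≡ x * h + a + c * (x * g + b)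
        regroup = solve-∀

    linearProduct : (ℕ → ℕ) → ℕ → ℤ → ℤ
    linearProduct c zero x = 1ℤ
    linearProduct c (suc n) x = (x + + c 0) * linearProduct (c ∘ suc) n x

    linearProduct-constant : ∀ c n x → linearProduct (λ _ → c) n x ≡ (x + + c) ℤ.^ n
    linearProduct-constant c zero x = refl
    linearProduct-constant c (suc n) x = cong ((x + + c) *_) (linearProduct-constant c n x)

    ∏lin-degree : ∀ c n → Degree≤ n (∏ (lin ∘ c) n)
    ∏lin-degree c zero (suc j) _ = refl
    ∏lin-degree c (suc n) = lin⊛-degree (c 0) n _ (∏lin-degree (c ∘ suc) n)

    ∏lin-constant : ∀ c n → ∏ (lin ∘ c) n 0 ≡ 1ℤ
    ∏lin-constant c zero = refl
    ∏lin-constant c (suc n) = trans (lin⊛-zero (c 0) (∏ (lin ∘ c ∘ suc) n)) (∏lin-constant (c ∘ suc) n)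

    horner-∏lin : ∀ c n x → horner n (∏ (lin ∘ c) n) x ≡ linearProduct c n x
    horner-∏lin c zero x = refl
    horner-∏lin c (suc n) x =
      trans (horner-lin⊛ (c 0) n _ x (∏lin-degree (c ∘ suc) n))
            (cong ((x + + c 0) *_) (horner-∏lin (c ∘ suc) n x))

  module PowerOfOneMinusMonomial where
    open PowerSeries
    open import Data.Nat.Combinatorics using (_C_; nCk+nC[k+1]≡[n+1]C[k+1])
    open import Data.Integer.Properties using (pos-+)

    -- the recurrences of rhs coming from (1 - x^m)^{k+1} = (1 - x^m)^k - x^m (1 - x^m)^k
    rhs-below : ∀ k c → rhs k 0 c ≡ rhs (suc k) 0 c
    rhs-below k zero = refl
    rhs-below k (suc c) = refl

    rhs-pascal : ∀ k s c → rhs k (suc s) c - rhs k s c ≡ rhs (suc k) (suc s) c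
    rhs-pascal k s (suc c) = refl
    rhs-pascal k s zero = begin
        - sign s * + (k C suc s) - sign s * + (k C s)
      ≡⟨ collect (sign s) (+ (k C suc s)) (+ (k C s)) ⟩
        - sign s * (+ (k C s) + + (k C suc s))
      ≡⟨ cong (λ z → - sign s * z) (pos-+ (k C s) (k C suc s)) ⟨
        - sign s * + ((k C s) ℕ.+ (k C suc s))
      ≡⟨ cong (λ z → - sign s * + z) (nCk+nC[k+1]≡[n+1]C[k+1] k s) ⟩
        - sign s * + (suc k C suc s)
      ∎
      where
      open ≡-Reasoning
      collect : ∀ σ a b → - σ * a - σ * b ≡ - σ * (b + a)
      collect = solve-∀

    power-one-minus-monomial : ∀ q k s c → c ℕ.≤ q →
      power (mono 0 ⊖ mono (suc q)) k (s ℕ.* suc q ℕ.+ c) ≡ rhs k s c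
    power-one-minus-monomial q zero zero zero _ = refl
    power-one-minus-monomial q zero zero (suc c) _ = refl
    power-one-minus-monomial q zero (suc s) zero _ = sym (*-zeroʳ (sign (suc s)))
    power-one-minus-monomial q zero (suc s) (suc c) _ = refl
    power-one-minus-monomial q (suc k) s c c≤q = begin
        ((mono 0 ⊖ mono m) ⊛ P) N
      ≡⟨ ⊛-distribʳ-⊖ (mono 0) (mono m) P N ⟩
        (mono 0 ⊛ P) N - (mono m ⊛ P) N
      ≡⟨ cong (_- (mono m ⊛ P) N) (mono⊛-≤ 0 P N z≤n) ⟩
        P N - (mono m ⊛ P) N
      ≡⟨ shifted s ⟩
        rhs (suc k) s c
      ∎
      where
      open ≡-Reasoning
      m N : ℕ
      m = suc q
      N = s ℕ.* m ℕ.+ c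
      P : Series
      P = power (mono 0 ⊖ mono m) k
      shifted : ∀ s → P (s ℕ.* m ℕ.+ c) - (mono m ⊛ P) (s ℕ.* m ℕ.+ c) ≡ rhs (suc k) s c
      shifted zero = begin
          P c - (mono m ⊛ P) c
        ≡⟨ cong (_-_ (P c)) (mono⊛-> m P c (s≤s c≤q)) ⟩
          P c - 0ℤ
        ≡⟨ +-identityʳ (P c) ⟩
          P c
        ≡⟨ power-one-minus-monomial q k zero c c≤q ⟩
          rhs k 0 c
        ≡⟨ rhs-below k c ⟩
          rhs (suc k) 0 c
        ∎
      shifted (suc s) = begin
          P (suc s ℕ.* m ℕ.+ c) - (mono m ⊛ P) (suc s ℕ.* m ℕ.+ c)
        ≡⟨ cong (_-_ (P (suc s ℕ.* m ℕ.+ c))) (mono⊛-≤ m P (suc s ℕ.* m ℕ.+ c) m≤) ⟩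
          P (suc s ℕ.* m ℕ.+ c) - P (suc s ℕ.* m ℕ.+ c ℕ.∸ m)
        ≡⟨ cong (λ i → P (suc s ℕ.* m ℕ.+ c) - P i) drop-m ⟩
          P (suc s ℕ.* m ℕ.+ c) - P (s ℕ.* m ℕ.+ c)
        ≡⟨ cong₂ _-_ (power-one-minus-monomial q k (suc s) c c≤q) (power-one-minus-monomial q k s c c≤q) ⟩
          rhs k (suc s) c - rhs k s c
        ≡⟨ rhs-pascal k s c ⟩
          rhs (suc k) (suc s) c
        ∎
        where
        m≤ : m ℕ.≤ suc s ℕ.* m ℕ.+ c
        m≤ = ℕP.≤-trans (ℕP.m≤m+n m (s ℕ.* m)) (ℕP.m≤m+n (m ℕ.+ s ℕ.* m) c)
        drop-m : suc s ℕ.* m ℕ.+ c ℕ.∸ m ≡ s ℕ.* m ℕ.+ c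
        drop-m = trans (cong (ℕ._∸ m) (ℕP.+-assoc m (s ℕ.* m) c)) (ℕP.m+n∸m≡n m (s ℕ.* m ℕ.+ c))

  module SeriesModulo (p : ℕ) where
    open PowerSeries
    open HornerEvaluation
    open Congruence p

    infix 4 _≈ₛ_
    _≈ₛ_ : Series → Series → Set
    F ≈ₛ G = ∀ j → F j ≈ G j

    ⊛-cong≈ : ∀ {F F′ G G′} → F ≈ₛ F′ → G ≈ₛ G′ → F ⊛ G ≈ₛ F′ ⊛ G′
    ⊛-cong≈ eF eG zero = *-cong (eF 0) (eG 0)
    ⊛-cong≈ eF eG (suc n) = +-cong (*-cong (eF 0) (eG (suc n))) (⊛-cong≈ (eF ∘ suc) eG n)

    power-cong≈ : ∀ {F G} → F ≈ₛ G → ∀ k → power F k ≈ₛ power G k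
    power-cong≈ e zero = λ _ → ≈-refl
    power-cong≈ e (suc k) = ⊛-cong≈ e (power-cong≈ e k)

    horner-cong≈ : ∀ {F G} → F ≈ₛ G → ∀ n x → horner n F x ≈ horner n G x
    horner-cong≈ e zero x = e 0
    horner-cong≈ e (suc n) x = +-cong (*-cong (≈-refl {x}) (horner-cong≈ e n x)) (e (suc n))

    -- F (j + 1) = partials F a (j + 1) - a · partials F a j, so if the partial
    -- sums vanish up to n, so do the coefficients
    coefficients-from-partials : ∀ n F a → (∀ j → j ℕ.≤ n → horner j F a ≈ 0ℤ) →
      ∀ j → j ℕ.≤ n → F j ≈ 0ℤ
    coefficients-from-partials n F a vanish zero _ = vanish 0 z≤n
    coefficients-from-partials n F a vanish (suc j) j<n = begin
        F (suc j)
      ≡⟨ isolate a (horner j F a) (F (suc j)) ⟩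
        horner (suc j) F a - a * horner j F a
      ≈⟨ +-cong (vanish (suc j) j<n) (-‿cong (*-cong (≈-refl {a}) (vanish j (ℕP.<⇒≤ j<n)))) ⟩
        0ℤ - a * 0ℤ
      ≡⟨ cong (_-_ 0ℤ) (*-zeroʳ a) ⟩
        0ℤ
      ∎
      where
      open ≈-Reasoning
      isolate : ∀ a h b → b ≡ (a * h + b) - a * h
      isolate = solve-∀

  module AtPrime (q : ℕ) (prime : Prime (suc (suc q))) where
    open PowerSeries
    open HornerEvaluation
    open Binomials
    open PowerOfOneMinusMonomial
    open CompositionSums using (compSum-as-coefficient)
    open Congruence (suc (suc q))
    open SeriesModulo (suc (suc q))
    open import Data.Nat.Primality using (euclidsLemma)
    import Data.Nat.Divisibility as ℕD
    open import Data.Nat.Combinatorics using (_C_; nCn≡1; k>n⇒nCk≡0)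
    open import Data.Integer.Properties using (abs-*; m-n≡m⊖n; ⊖-<; neg-involutive)
    open import Data.Sum using (inj₁; inj₂)
    open import Relation.Nullary using (¬_; yes; no)
    open import Relation.Binary.Definitions using (tri<; tri≈; tri>)

    p m : ℕ
    p = suc (suc q)
    m = suc q

    ¬multiple : ∀ d → 0 ℕ.< d → d ℕ.< p → ¬ (p ℕD.∣ d)
    ¬multiple (suc d) _ d<p p∣d = ℕP.<⇒≱ d<p (ℕD.∣⇒≤ p∣d)

    ¬multiple-difference : ∀ b a → b ℕ.< a → a ℕ.< p → ¬ (+ p Signed.∣ + b - + a)
    ¬multiple-difference b a b<a a<p p∣b-a =
      ¬multiple (a ℕ.∸ b) (ℕP.m<n⇒0<n∸m b<a) (ℕP.≤-<-trans (ℕP.m∸n≤m a b) a<p) (∣⇒∣ᵤ p∣a-b)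
      where
      b-a≡-[a-b] : + b - + a ≡ - + (a ℕ.∸ b)
      b-a≡-[a-b] = trans (m-n≡m⊖n b a) (⊖-< b<a)
      p∣a-b : + p Signed.∣ + (a ℕ.∸ b)
      p∣a-b = subst (+ p Signed.∣_) (trans (cong -_ b-a≡-[a-b]) (neg-involutive _)) (∣m⇒∣-m p∣b-a)

    cancelˡ : ∀ {a b} → ¬ (+ p Signed.∣ a) → a * b ≈ 0ℤ → b ≈ 0ℤ
    cancelˡ {a} {b} p∤a ab≈0
      with euclidsLemma ℤ.∣ a ∣ ℤ.∣ b ∣ prime (subst (p ℕD.∣_) (abs-* a b) (∣⇒∣ᵤ (≈0⇒multiple ab≈0)))
    ... | inj₁ p∣a = ⊥-elim (p∤a (∣ᵤ⇒∣ p∣a))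
    ... | inj₂ p∣b = multiple⇒≈0 (∣ᵤ⇒∣ p∣b)

    -- p ∣ C(p, j) for 0 < j < p, since j C(p, j) = p C(p - 1, j - 1)
    p∣binomial : ∀ j → 0 ℕ.< j → j ℕ.< p → p ℕD.∣ (p C j)
    p∣binomial (suc k) _ j<p with euclidsLemma (suc k) (p C suc k) prime p∣jC
      where
      p∣jC : p ℕD.∣ suc k ℕ.* (p C suc k)
      p∣jC = subst (p ℕD.∣_) (sym (absorption m k)) (ℕD.m∣m*n (m C k))
    ... | inj₁ p∣j = ⊥-elim (¬multiple (suc k) (s≤s z≤n) j<p p∣j)
    ... | inj₂ p∣C = p∣C

    binomial-coefficients : power (lin 1) p ≈ₛ mono 0 ⊕ mono p
    binomial-coefficients j = ≈-trans (≡⇒≈ (power-lin 1 p j)) (reduce j)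
      where
      reduce : ∀ j → binomialSeries p 1 j ≈ (mono 0 ⊕ mono p) j
      reduce zero = ≈-refl
      reduce (suc j) with ℕP.<-cmp (suc j) p
      ... | tri< j<p j≢p _ =
        ≈-trans (multiple⇒≈0 (∣ᵤ⇒∣ (ℕD.∣m⇒∣m*n (1 ℕ.^ suc j) (p∣binomial (suc j) (s≤s z≤n) j<p))))
                (≡⇒≈ (sym (trans (+-identityˡ _) (mono-off m j (j≢p ∘ cong suc)))))
      ... | tri≈ _ refl _ =
        ≡⇒≈ (trans (cong₂ (λ u v → + (u ℕ.* v)) (nCn≡1 p) (ℕP.^-zeroˡ p)) (cong (_+_ 0ℤ) (sym (mono-diag m))))
      ... | tri> _ j≢p j>p =
        ≡⇒≈ (trans (cong (λ u → + (u ℕ.* 1 ℕ.^ suc j)) (k>n⇒nCk≡0 j>p))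
                   (sym (trans (+-identityˡ _) (mono-off m j (j≢p ∘ cong suc)))))

    -- (x + 1)^p ≡ x^p + 1, evaluating the previous identity by Horner's rule
    freshmans-dream : ∀ x → (x + 1ℤ) ℤ.^ p ≈ x ℤ.^ p + 1ℤ
    freshmans-dream x = begin
        (x + 1ℤ) ℤ.^ p
      ≡⟨ trans (horner-∏lin (λ _ → 1) p x) (linearProduct-constant 1 p x) ⟨
        horner p (power (lin 1) p) x
      ≈⟨ horner-cong≈ binomial-coefficients p x ⟩
        horner p (mono 0 ⊕ mono p) x
      ≡⟨ trans (horner-⊕ p (mono 0) (mono p) x) (cong₂ _+_ (horner-mono-bottom p x) (horner-mono-top p x)) ⟩
        x ℤ.^ p + 1ℤ
      ∎
      where open ≈-Reasoning

    fermat : ∀ a → (+ a) ℤ.^ p ≈ + a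
    fermat zero = ≡⇒≈ (*-zeroˡ (0ℤ ℤ.^ m))
    fermat (suc a) = begin
        (+ suc a) ℤ.^ p
      ≡⟨ cong (λ z → z ℤ.^ p) a+1 ⟩
        (+ a + 1ℤ) ℤ.^ p
      ≈⟨ freshmans-dream (+ a) ⟩
        (+ a) ℤ.^ p + 1ℤ
      ≈⟨ +-cong (fermat a) (≈-refl {1ℤ}) ⟩
        + a + 1ℤ
      ≡⟨ a+1 ⟨
        + suc a
      ∎
      where
      open ≈-Reasoning
      a+1 : + suc a ≡ + a + 1ℤ
      a+1 = cong +_ (ℕP.+-comm 1 a)

    little-fermat : ∀ a → 0 ℕ.< a → a ℕ.< p → (+ a) ℤ.^ m ≈ 1ℤ
    little-fermat a 0<a a<p = begin
        (+ a) ℤ.^ m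
      ≡⟨ shift ((+ a) ℤ.^ m) ⟩
        ((+ a) ℤ.^ m - 1ℤ) + 1ℤ
      ≈⟨ +-cong (cancelˡ {+ a} (¬multiple a 0<a a<p ∘ ∣⇒∣ᵤ) factored) (≈-refl {1ℤ}) ⟩
        0ℤ + 1ℤ
      ∎
      where
      open ≈-Reasoning
      shift : ∀ y → y ≡ (y - 1ℤ) + 1ℤ
      shift = solve-∀
      expand : ∀ a y → a * (y - 1ℤ) ≡ a * y - a
      expand = solve-∀
      factored : + a * ((+ a) ℤ.^ m - 1ℤ) ≈ 0ℤ
      factored = begin
          + a * ((+ a) ℤ.^ m - 1ℤ)
        ≡⟨ expand (+ a) ((+ a) ℤ.^ m) ⟩
          (+ a) ℤ.^ p - + a
        ≈⟨ +-cong (fermat a) (≈-refl { - + a}) ⟩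
          + a - + a
        ≡⟨ +-inverseʳ (+ a) ⟩
          0ℤ
        ∎

    linearProduct-root : ∀ c n x i → i ℕ.< n → x + + c i ≈ 0ℤ → linearProduct c n x ≈ 0ℤ
    linearProduct-root c (suc n) x zero _ root =
      ≈-trans (*-cong root (≈-refl {linearProduct (c ∘ suc) n x})) (≡⇒≈ (*-zeroˡ (linearProduct (c ∘ suc) n x)))
    linearProduct-root c (suc n) x (suc i) (s≤s i<n) root =
      ≈-trans (*-cong (≈-refl {x + + c 0}) (linearProduct-root (c ∘ suc) n x i i<n root)) (≡⇒≈ (*-zeroʳ (x + + c 0)))

    -- (a + 1)(a + 2)⋯(a + p - 1) ≡ 0 for 0 < a < p: the factor a + (p - a) is p
    rising-vanishes : ∀ a → 1 ℕ.≤ a → a ℕ.≤ m → linearProduct suc m (+ a) ≈ 0ℤ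
    rising-vanishes a 1≤a a≤m =
      linearProduct-root suc m (+ a) (m ℕ.∸ a) (ℕP.∸-monoʳ-< 1≤a a≤m) (multiple⇒≈0 p∣factor)
      where
      factor≡p : + a + + suc (m ℕ.∸ a) ≡ + p
      factor≡p = cong +_ (trans (ℕP.+-suc a (m ℕ.∸ a)) (cong suc (ℕP.m+[n∸m]≡n a≤m)))
      p∣factor : + p Signed.∣ + a + + suc (m ℕ.∸ a)
      p∣factor = subst (+ p Signed.∣_) (sym factor≡p) Signed.∣-refl

    vanishing-polynomial : ∀ n → n ℕ.< p → ∀ F → F 0 ≈ 0ℤ →
      (∀ a → 1 ℕ.≤ a → a ℕ.≤ n → horner n F (+ a) ≈ 0ℤ) → ∀ j → j ℕ.≤ n → F j ≈ 0ℤ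
    vanishing-polynomial zero _ F F0≈0 _ zero _ = F0≈0
    vanishing-polynomial (suc n) n<p F F0≈0 roots =
      coefficients-from-partials (suc n) F a partials-vanish
      where
      a : ℤ
      a = + suc n
      root-a : horner (suc n) F a ≈ 0ℤ
      root-a = roots (suc n) (s≤s z≤n) ℕP.≤-refl
      isolate : ∀ u v → u ≡ (u + v) - v
      isolate = solve-∀
      -- the quotient of F by x - a keeps the roots 1, …, n, as b - a is invertible
      quotient-roots : ∀ b → 1 ℕ.≤ b → b ℕ.≤ n → horner n (partials F a) (+ b) ≈ 0ℤ
      quotient-roots b 1≤b b≤n = cancelˡ (¬multiple-difference b (suc n) (s≤s b≤n) n<p) (begin
          (+ b - a) * horner n (partials F a) (+ b)
        ≡⟨ trans (isolate _ (horner (suc n) F a)) (cong (_- horner (suc n) F a) (sym (horner-division n F a (+ b)))) ⟩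
          horner (suc n) F (+ b) - horner (suc n) F a
        ≈⟨ +-cong (roots b 1≤b (ℕP.m≤n⇒m≤1+n b≤n)) (-‿cong root-a) ⟩
          0ℤ - 0ℤ
        ∎)
        where open ≈-Reasoning
      partials-vanish : ∀ j → j ℕ.≤ suc n → horner j F a ≈ 0ℤ
      partials-vanish j j≤1+n with ℕP.m≤n⇒m<n∨m≡n j≤1+n
      ... | inj₁ (s≤s j≤n) =
        vanishing-polynomial n (ℕP.<-trans (ℕP.n<1+n n) n<p) (partials F a) F0≈0 quotient-roots j j≤n
      ... | inj₂ refl = root-a

    linearFactors oneMinusXᵐ : Series
    linearFactors = ∏ (lin ∘ suc) m
    oneMinusXᵐ = mono 0 ⊖ mono m

    difference-roots : ∀ a → 1 ℕ.≤ a → a ℕ.≤ m → horner m (linearFactors ⊖ oneMinusXᵐ) (+ a) ≈ 0ℤ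
    difference-roots a 1≤a a≤m = begin
        horner m (linearFactors ⊖ oneMinusXᵐ) (+ a)
      ≡⟨ horner-⊖ m linearFactors oneMinusXᵐ (+ a) ⟩
        horner m linearFactors (+ a) - horner m oneMinusXᵐ (+ a)
      ≡⟨ cong₂ _-_ (horner-∏lin suc m (+ a))
                   (trans (horner-⊖ m (mono 0) (mono m) (+ a))
                          (cong₂ _-_ (horner-mono-bottom m (+ a)) (horner-mono-top m (+ a)))) ⟩
        linearProduct suc m (+ a) - ((+ a) ℤ.^ m - 1ℤ)
      ≈⟨ +-cong (rising-vanishes a 1≤a a≤m) (-‿cong (+-cong (little-fermat a 1≤a (s≤s a≤m)) (≈-refl { - 1ℤ}))) ⟩
        0ℤ - (1ℤ - 1ℤ)
      ∎
      where open ≈-Reasoning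

    -- the difference vanishes: up to degree m by counting roots, beyond by degree
    difference-vanishes : ∀ j → (linearFactors ⊖ oneMinusXᵐ) j ≈ 0ℤ
    difference-vanishes j with j ℕP.≤? m
    ... | yes j≤m = vanishing-polynomial m ℕP.≤-refl (linearFactors ⊖ oneMinusXᵐ) leading difference-roots j j≤m
      where
      leading : (linearFactors ⊖ oneMinusXᵐ) 0 ≈ 0ℤ
      leading = ≡⇒≈ (cong (_- oneMinusXᵐ 0) (∏lin-constant suc m))
    ... | no j≰m = ≡⇒≈ (cong₂ _-_ (∏lin-degree suc m j (ℕP.≰⇒> j≰m))
                                  (cong₂ _-_ (mono-off 0 j (λ { refl → j≰m z≤n }))
                                             (mono-off m j (λ { refl → j≰m ℕP.≤-refl }))))

    product-identity : linearFactors ≈ₛ oneMinusXᵐ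
    product-identity j = begin
        linearFactors j
      ≡⟨ split (linearFactors j) (oneMinusXᵐ j) ⟩
        (linearFactors ⊖ oneMinusXᵐ) j + oneMinusXᵐ j
      ≈⟨ +-cong (difference-vanishes j) ≈-refl ⟩
        0ℤ + oneMinusXᵐ j
      ≡⟨ +-identityˡ (oneMinusXᵐ j) ⟩
        oneMinusXᵐ j
      ∎
      where
      open ≈-Reasoning
      split : ∀ e f → e ≡ (e - f) + f
      split = solve-∀

    main-congruence : ∀ k s c → c ℕ.≤ q → + compSum k m (m ℕ.* s ℕ.+ c) ≈ rhs k s c
    main-congruence k s c c≤q = begin
        + compSum k m (m ℕ.* s ℕ.+ c)
      ≡⟨ compSum-as-coefficient k m (m ℕ.* s ℕ.+ c) ⟩
        power linearFactors k (m ℕ.* s ℕ.+ c)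
      ≈⟨ power-cong≈ product-identity k (m ℕ.* s ℕ.+ c) ⟩
        power oneMinusXᵐ k (m ℕ.* s ℕ.+ c)
      ≡⟨ cong (λ i → power oneMinusXᵐ k (i ℕ.+ c)) (ℕP.*-comm m s) ⟩
        power oneMinusXᵐ k (s ℕ.* m ℕ.+ c)
      ≡⟨ power-one-minus-monomial q k s c c≤q ⟩
        rhs k s c
      ∎
      where open ≈-Reasoning

open import Data.Nat using (ℕ; suc; _+_; _*_; _∸_; _≤_)
open import Data.Nat.Primality using (Prime; prime⇒nonTrivial)
open import Data.Integer using (+_)

lemma2p1 : (p k s c : ℕ) → Prime p → c ≤ p ∸ 2 →
    (+ compSum k (p ∸ 1) ((p ∸ 1) * s + c)) ≡ rhs k s c [modℤ p ]
-- p = 0 and p = 1 are not prime; for p = q + 2 the congruence is main-congruence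
lemma2p1 0 k s c pr le with prime⇒nonTrivial pr
... | ()
lemma2p1 1 k s c pr le with prime⇒nonTrivial pr
... | ()
lemma2p1 (suc (suc q)) k s c pr c≤q = ≈⇒[modℤ] (main-congruence k s c c≤q)
  where
  open Proof.Congruence (suc (suc q)) using (≈⇒[modℤ])
  open Proof.AtPrime q pr using (main-congruence)
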